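{- Let $k\ge1$, let $X\subseteq\mathbb{I}$ with $Q^k\subseteq X^k\subseteq\mathbb{I}^k$, and let $\Psi:X^k\to\mathbb{N}^{\mathbb{N}}$ be continuous at each point of $Q^k$. Then there exists $g\in\mathbb{N}^{\mathbb{N}}$ such that for each $n\in\mathbb{N}$ and all $x_1,\dots,x_k\in X$: if $g(n)<\min\{x_1(n),\dots,x_k(n)\}$, then $\Psi(x_1,\dots,x_k)(n)\le g(n)$.
   Context: Let $\overline{\mathbb{N}}=\mathbb{N}\cup\{\infty\}$ be the one-point compactification of $\mathbb{N}$ (with $n<\infty$ for all $n\in\mathbb{N}$). Let $\mathbb{I}\subseteq\overline{\mathbb{N}}^{\mathbb{N}}$ (product topology) be the set of nondecreasing functions $f$ with $f(n)<f(n+1)$ whenever $f(n)<\infty$. For each finite strictly increasing sequence $s$ of natural numbers, $q_s\in\mathbb{I}$ is given by $q_s(k)=s(k)$ for $k<|s|$ and $q_s(k)=\infty$ otherwise; $Q=\{q_s\}$. $\mathbb{N}^{\mathbb{N}}$ carries the product (Baire space) topology. -}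

module Defs where

open import Data.Nat using (ℕ; zero; suc; _<_; _≤_)
open import Data.List using (List; []; _∷_; length; lookup)
open import Data.List.Relation.Unary.Linked using (Linked)
open import Data.Fin using (Fin; fromℕ<)
open import Data.Empty using (⊥)
open import Data.Unit using (⊤)
open import Data.Product using (Σ; ∃; _×_)
open import Relation.Binary.PropositionalEquality using (_≡_)
open import Relation.Nullary using (yes; no)
open import Data.Nat using (_<?_)

data ℕ̄ : Set where
  fin : ℕ → ℕ̄
  ∞   : ℕ̄

_<̄_ : ℕ̄ → ℕ̄ → Set
fin a <̄ fin b = a < b
fin a <̄ ∞     = ⊤
∞     <̄ _     = ⊥

_≤̄_ : ℕ̄ → ℕ̄ → Set
fin a ≤̄ fin b = a ≤ b
_     ≤̄ ∞     = ⊤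
∞     ≤̄ fin b = ⊥

Seq̄ : Set
Seq̄ = ℕ → ℕ̄

Is𝕀 : Seq̄ → Set
Is𝕀 f = ∀ n → (f n ≤̄ f (suc n)) × (∀ a → f n ≡ fin a → f n <̄ f (suc n))

q : List ℕ → Seq̄
q s k with k <? length s
... | yes k<l = fin (lookup s (fromℕ< k<l))
... | no  _   = ∞

InQ : Seq̄ → Set
InQ x = Σ (List ℕ) λ s → Linked _<_ s × (∀ n → x n ≡ q s n)

-- basic neighbourhoods in ℕ̄ : {a} for finite a, (M,∞] for ∞
Close : ℕ → ℕ̄ → ℕ̄ → Set
Close M (fin a) b = b ≡ fin a
Close M ∞       b = fin M <̄ b

-- basic neighbourhood of x in the product topology on ℕ̄^ℕ
-- (constraint on coordinates i < N, parameter M for infinite coordinates)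
Near : ℕ → ℕ → Seq̄ → Seq̄ → Set
Near N M x y = ∀ i → i < N → Close M (x i) (y i)

ContinuousAt : (k : ℕ) (X : Seq̄ → Set)
  → (Ψ : (xs : Fin k → Seq̄) → (∀ j → X (xs j)) → ℕ → ℕ)
  → (p : Fin k → Seq̄) → (∀ j → X (p j)) → Set
ContinuousAt k X Ψ p hp =
  ∀ m → Σ ℕ λ N → Σ ℕ λ M →
    ∀ (ys : Fin k → Seq̄) (hy : ∀ j → X (ys j)) →
      (∀ j → Near N M (p j) (ys j)) →
      ∀ i → i < m → Ψ ys hy i ≡ Ψ p hp i

module Submission where

-- Fix n. For finite increasing prefixes s = (s₁, …, s_k), continuity at (q_{s₁}, …, q_{s_k}) gives M such that
-- Ψ(x)(n) is constant on tuples x with each xⱼ extending sⱼ and xⱼ(|sⱼ|) > M. Any other tuple extending s has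
-- some xⱼ(|sⱼ|) = a ≤ M, so it extends the longer prefix (sⱼ, a); the requirement that xⱼ(n) exceed the bound,
-- itself at least M ≥ a, forces |sⱼ| < n.
-- Recursing over these finitely many extensions (the total length stays below k·n) yields a bound for s, and
-- the empty prefixes yield g(n).

open import Defs
open import Data.Nat using (ℕ; zero; suc; _<_; _≤_; _≤′_; ≤′-refl; ≤′-step; _∸_; z≤n; s≤s; _<?_)
open import Data.Nat.Properties
  using ( ≤-refl; ≤-reflexive; ≤-trans; <-≤-trans; ≤-<-trans; <-irrefl; <⇒≤; ≮⇒≥; ≰⇒>; ≤⇒≤′; n<1+n
        ; +-comm; +-mono-≤; +-mono-<-≤; +-mono-≤-<; ∸-monoʳ-<; +-0-monoid)
open import Data.Nat.Induction using (<-wellFounded)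
open import Data.Fin using (Fin; zero; suc; fromℕ<; _≟_)
open import Data.Fin.Properties using (all?; ¬∀⟶∃¬)
open import Data.Vec.Functional using (Vector; updateAt)
open import Data.Vec.Functional.Properties using (updateAt-updates; updateAt-minimal)
open import Data.List using (List; []; _∷_; length; lookup; _∷ʳ_; allFin; upTo; cartesianProductWith)
open import Data.List.Properties using (length-++)
open import Data.List.Relation.Unary.Linked using (Linked; []; [-]; _∷_; linked?)
import Data.List.Relation.Unary.All as All
open import Data.List.Relation.Unary.Any using (here; there)
open import Data.List.Membership.Propositional.Properties using (∈-cartesianProductWith⁺; ∈-allFin; ∈-upTo⁺)
open import Data.List.Extrema.Nat using (max; ⊥≤max; xs≤max)
open import Data.Product using (Σ; _×_; _,_; proj₁; proj₂)
open import Data.Unit using (⊤; tt)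
open import Function using (_∘_)
open import Induction.WellFounded using (Acc; acc)
open import Relation.Binary.PropositionalEquality
open import Relation.Nullary using (Dec; yes; no; ¬_; contradiction; _×-dec_)
open import Algebra.Properties.Monoid.Sum +-0-monoid using (sum)

≤̄-refl : ∀ x → x ≤̄ x
≤̄-refl (fin a) = ≤-refl
≤̄-refl ∞       = tt

≤̄-trans : ∀ {x y z} → x ≤̄ y → y ≤̄ z → x ≤̄ z
≤̄-trans {fin a} {fin b} {fin c} a≤b b≤c = ≤-trans a≤b b≤c
≤̄-trans {fin a} {_}     {∞}     _   _   = tt
≤̄-trans {∞}     {_}     {∞}     _   _   = tt
≤̄-trans {fin a} {∞}     {fin c} _   ()
≤̄-trans {∞}     {∞}     {fin c} _   ()

<̄-≤̄-trans : ∀ {x y z} → x <̄ y → y ≤̄ z → x <̄ z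
<̄-≤̄-trans {fin a} {fin b} {fin c} a<b b≤c = <-≤-trans a<b b≤c
<̄-≤̄-trans {fin a} {_}     {∞}     _   _   = tt
<̄-≤̄-trans {fin a} {∞}     {fin c} _   ()

≤-<̄-trans : ∀ {a b} x → a ≤ b → fin b <̄ x → fin a <̄ x
≤-<̄-trans (fin c) a≤b b<c = ≤-<-trans a≤b b<c
≤-<̄-trans ∞       _   _   = tt

fin<̄? : ∀ a x → Dec (fin a <̄ x)
fin<̄? a (fin b) = a <? b
fin<̄? a ∞       = yes tt

fin≮̄⇒fin≤ : ∀ {a} x → ¬ (fin a <̄ x) → Σ ℕ λ b → x ≡ fin b × b ≤ a
fin≮̄⇒fin≤ (fin b) a≮b = b , refl , ≮⇒≥ a≮b
fin≮̄⇒fin≤ ∞       a≮∞ = contradiction tt a≮∞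

module _ {x : Seq̄} (x∈𝕀 : Is𝕀 x) where

  Is𝕀-monotone : ∀ {i j} → i ≤ j → x i ≤̄ x j
  Is𝕀-monotone = go ∘ ≤⇒≤′
    where
    go : ∀ {i j} → i ≤′ j → x i ≤̄ x j
    go ≤′-refl       = ≤̄-refl _
    go (≤′-step i≤j) = ≤̄-trans (go i≤j) (proj₁ (x∈𝕀 _))

  Is𝕀-strict : ∀ {i a b} → x i ≡ fin a → x (suc i) ≡ fin b → a < b
  Is𝕀-strict {i} {a} xᵢ≡a xᵢ₊₁≡b = subst₂ _<̄_ xᵢ≡a xᵢ₊₁≡b (proj₂ (x∈𝕀 i) a xᵢ≡a)

  Is𝕀-reflects-< : ∀ {m n a} → x m ≡ fin a → fin a <̄ x n → m < n
  Is𝕀-reflects-< {m} {n} xₘ≡a a<xₙ = ≰⇒> λ n≤m →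
    <-irrefl refl (<̄-≤̄-trans a<xₙ (subst (x n ≤̄_) xₘ≡a (Is𝕀-monotone n≤m)))

q′ : List ℕ → Seq̄
q′ []      _       = ∞
q′ (y ∷ s) zero    = fin y
q′ (y ∷ s) (suc i) = q′ s i

lookup≡q′ : ∀ s {i} (i<∣s∣ : i < length s) → fin (lookup s (fromℕ< i<∣s∣)) ≡ q′ s i
lookup≡q′ (y ∷ s) {zero}  _           = refl
lookup≡q′ (y ∷ s) {suc i} (s≤s i<∣s∣) = lookup≡q′ s i<∣s∣

q′-beyond : ∀ s {i} → length s ≤ i → ∞ ≡ q′ s i
q′-beyond []      _                   = refl
q′-beyond (y ∷ s) {suc i} (s≤s ∣s∣≤i) = q′-beyond s ∣s∣≤i

q≗q′ : ∀ s → q s ≗ q′ s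
q≗q′ s i with i <? length s
... | yes i<∣s∣ = lookup≡q′ s i<∣s∣
... | no  i≮∣s∣ = q′-beyond s (≮⇒≥ i≮∣s∣)

Extends : List ℕ → Seq̄ → Set
Extends []      x = ⊤
Extends (y ∷ s) x = x 0 ≡ fin y × Extends s (x ∘ suc)

extends-∷ʳ : ∀ s {x a} → Extends s x → x (length s) ≡ fin a → Extends (s ∷ʳ a) x
extends-∷ʳ []      _              xₗ≡a = xₗ≡a , tt
extends-∷ʳ (y ∷ s) (x₀≡y , x⊒s) xₗ≡a = x₀≡y , extends-∷ʳ s x⊒s xₗ≡a

extends⇒linked-∷ʳ : ∀ s {x a} → Is𝕀 x → Linked _<_ s → Extends s x →
                    x (length s) ≡ fin a → Linked _<_ (s ∷ʳ a)
extends⇒linked-∷ʳ []                x∈𝕀 _          _          _    = [-]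
extends⇒linked-∷ʳ (y ∷ [])          x∈𝕀 _          (x₀≡y , _) x₁≡a = Is𝕀-strict x∈𝕀 x₀≡y x₁≡a ∷ [-]
extends⇒linked-∷ʳ (y ∷ s@(_ ∷ _)) x∈𝕀 (y<z ∷ s↑) (_ , x⊒s)   xₗ≡a =
  y<z ∷ extends⇒linked-∷ʳ s (x∈𝕀 ∘ suc) s↑ x⊒s xₗ≡a

extends⇒close : ∀ s {x M} → Is𝕀 x → Extends s x → fin M <̄ x (length s) →
                ∀ i → Close M (q′ s i) (x i)
extends⇒close []      x∈𝕀 _            M<x₀ i       = <̄-≤̄-trans M<x₀ (Is𝕀-monotone x∈𝕀 z≤n)
extends⇒close (y ∷ s) x∈𝕀 (x₀≡y , _)   _    zero    = x₀≡y
extends⇒close (y ∷ s) x∈𝕀 (_ , x⊒s)    M<xₗ (suc i) = extends⇒close s (x∈𝕀 ∘ suc) x⊒s M<xₗ i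

extends⇒near : ∀ s {x} N M → Is𝕀 x → Extends s x → fin M <̄ x (length s) → Near N M (q s) x
extends⇒near s {x} N M x∈𝕀 x⊒s M<xₗ i _ =
  subst (λ z → Close M z (x i)) (sym (q≗q′ s i)) (extends⇒close s x∈𝕀 x⊒s M<xₗ i)

sum-mono-≤ : ∀ {k} {f g : Vector ℕ k} → (∀ i → f i ≤ g i) → sum f ≤ sum g
sum-mono-≤ {zero}  f≤g = ≤-refl
sum-mono-≤ {suc k} f≤g = +-mono-≤ (f≤g _) (sum-mono-≤ (f≤g ∘ suc))

sum-mono-< : ∀ {k} {f g : Vector ℕ k} → (∀ i → f i ≤ g i) → ∀ j → f j < g j → sum f < sum g
sum-mono-< f≤g zero    fⱼ<gⱼ = +-mono-<-≤ fⱼ<gⱼ (sum-mono-≤ (f≤g ∘ suc))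
sum-mono-< f≤g (suc j) fⱼ<gⱼ = +-mono-≤-< (f≤g _) (sum-mono-< (f≤g ∘ suc) j fⱼ<gⱼ)

updateAt-pointwise : ∀ {k} {A : Set} (P : Fin k → A → Set) (xs : Vector A k) j {f : A → A} →
                     P j (f (xs j)) → (∀ i → i ≢ j → P i (xs i)) → ∀ i → P i (updateAt xs j f i)
updateAt-pointwise P xs j Pⱼ Pᵢ i with i ≟ j
... | yes refl = subst (P i) (sym (updateAt-updates i xs)) Pⱼ
... | no  i≢j  = subst (P i) (sym (updateAt-minimal i j xs i≢j)) (Pᵢ i i≢j)

∸-length-∷ʳ : ∀ {A : Set} n (s : List A) {a} → length s < n → n ∸ length (s ∷ʳ a) < n ∸ length s
∸-length-∷ʳ n s {a} ∣s∣<n rewrite length-++ s {a ∷ []} | +-comm (length s) 1 =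
  ∸-monoʳ-< (n<1+n _) ∣s∣<n

module BoundConstruction
  (k : ℕ) (X : Seq̄ → Set) (X⊆𝕀 : ∀ x → X x → Is𝕀 x)
  (Qᵏ⊆Xᵏ : ∀ (xs : Fin k → Seq̄) → (∀ j → InQ (xs j)) → ∀ j → X (xs j))
  (Ψ : (xs : Fin k → Seq̄) → (∀ j → X (xs j)) → ℕ → ℕ)
  (Ψ-continuous : ∀ (p : Fin k → Seq̄) → (∀ j → InQ (p j)) → (hp : ∀ j → X (p j)) → ContinuousAt k X Ψ p hp)
  (n : ℕ) where

  Prefixes : Set
  Prefixes = Vector (List ℕ) k

  Increasing : Prefixes → Set
  Increasing ss = ∀ j → Linked _<_ (ss j)

  Bounds : Prefixes → ℕ → Set
  Bounds ss B = ∀ (xs : Fin k → Seq̄) (hx : ∀ j → X (xs j)) → (∀ j → Extends (ss j) (xs j)) →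
                (∀ j → fin B <̄ xs j n) → Ψ xs hx n ≤ B

  remaining : Prefixes → ℕ
  remaining ss = sum λ j → n ∸ length (ss j)

  extend : Prefixes → Fin k → ℕ → Prefixes
  extend ss j a = updateAt ss j (_∷ʳ a)

  remaining-extend : ∀ ss j a → length (ss j) < n → remaining (extend ss j a) < remaining ss
  remaining-extend ss j a ∣ssⱼ∣<n =
    sum-mono-< (updateAt-pointwise Shrunk ss j (<⇒≤ shrinksⱼ) (λ _ _ → ≤-refl)) j
               (subst (λ s → n ∸ length s < n ∸ length (ss j)) (sym (updateAt-updates j ss)) shrinksⱼ)
    where
    Shrunk : Fin k → List ℕ → Set
    Shrunk i s = n ∸ length s ≤ n ∸ length (ss i)

    shrinksⱼ : n ∸ length (ss j ∷ʳ a) < n ∸ length (ss j)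
    shrinksⱼ = ∸-length-∷ʳ n (ss j) ∣ssⱼ∣<n

  module Step (ss : Prefixes) (ss↑ : Increasing ss)
              (extensions-bounded : ∀ j a → length (ss j) < n → Linked _<_ (ss j ∷ʳ a) →
                                    Σ ℕ (Bounds (extend ss j a))) where

    centre : Fin k → Seq̄
    centre j = q (ss j)

    centre∈Qᵏ : ∀ j → InQ (centre j)
    centre∈Qᵏ j = ss j , ss↑ j , λ _ → refl

    centre∈Xᵏ : ∀ j → X (centre j)
    centre∈Xᵏ = Qᵏ⊆Xᵏ centre centre∈Qᵏ

    M : ℕ
    M = proj₁ (proj₂ (Ψ-continuous centre centre∈Qᵏ centre∈Xᵏ (suc n)))

    Ψ-locally-constant : ∀ xs (hx : ∀ j → X (xs j)) → (∀ j → Extends (ss j) (xs j)) →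
                         (∀ j → fin M <̄ xs j (length (ss j))) → Ψ xs hx n ≡ Ψ centre centre∈Xᵏ n
    Ψ-locally-constant xs hx xs⊒ss large = proj₂ (proj₂ (Ψ-continuous centre centre∈Qᵏ centre∈Xᵏ (suc n))) xs hx
      (λ j → extends⇒near (ss j) _ M (X⊆𝕀 _ (hx j)) (xs⊒ss j) (large j)) n (n<1+n n)

    -- B is fixed before any tuple is seen, so every candidate extension gets a bound, 0 when it is not admissible.
    extension : ∀ j a → Σ ℕ λ B → length (ss j) < n → Linked _<_ (ss j ∷ʳ a) → Bounds (extend ss j a) B
    extension j a with length (ss j) <? n ×-dec linked? _<?_ (ss j ∷ʳ a)
    ... | yes (∣ssⱼ∣<n , ssⱼa↑) = let (B , bounded) = extensions-bounded j a ∣ssⱼ∣<n ssⱼa↑ in B , λ _ _ → bounded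
    ... | no ¬valid             = 0 , λ ∣ssⱼ∣<n ssⱼa↑ → contradiction (∣ssⱼ∣<n , ssⱼa↑) ¬valid

    Bᵉ : Fin k → ℕ → ℕ
    Bᵉ j a = proj₁ (extension j a)

    candidates : List ℕ
    candidates = Ψ centre centre∈Xᵏ n ∷ cartesianProductWith Bᵉ (allFin k) (upTo (suc M))

    B : ℕ
    B = max M candidates

    Bᵉ≤B : ∀ j {a} → a ≤ M → Bᵉ j a ≤ B
    Bᵉ≤B j a≤M = All.lookup (xs≤max M candidates)
      (there (∈-cartesianProductWith⁺ Bᵉ (∈-allFin j) (∈-upTo⁺ (s≤s a≤M))))

    ss-bounded : Bounds ss B
    ss-bounded xs hx xs⊒ss B<xs with all? (λ j → fin<̄? M (xs j (length (ss j))))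
    ... | yes large = ≤-trans (≤-reflexive (Ψ-locally-constant xs hx xs⊒ss large))
                              (All.lookup (xs≤max M candidates) (here refl))
    ... | no ¬large with j , ¬largeⱼ ← ¬∀⟶∃¬ k _ (λ j → fin<̄? M (xs j (length (ss j)))) ¬large
                    with a , xsⱼ≡a , a≤M ← fin≮̄⇒fin≤ (xs j (length (ss j))) ¬largeⱼ =
      ≤-trans (proj₂ (extension j a) ∣ssⱼ∣<n ssⱼa↑ xs hx xs⊒ssa Bᵉ<xs) (Bᵉ≤B j a≤M)
      where
      xsⱼ∈𝕀 : Is𝕀 (xs j)
      xsⱼ∈𝕀 = X⊆𝕀 _ (hx j)

      ∣ssⱼ∣<n : length (ss j) < n
      ∣ssⱼ∣<n = Is𝕀-reflects-< xsⱼ∈𝕀 xsⱼ≡a (≤-<̄-trans (xs j n) (≤-trans a≤M (⊥≤max M candidates)) (B<xs j))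

      ssⱼa↑ : Linked _<_ (ss j ∷ʳ a)
      ssⱼa↑ = extends⇒linked-∷ʳ (ss j) xsⱼ∈𝕀 (ss↑ j) (xs⊒ss j) xsⱼ≡a

      xs⊒ssa : ∀ i → Extends (extend ss j a i) (xs i)
      xs⊒ssa = updateAt-pointwise (λ i s → Extends s (xs i)) ss j (extends-∷ʳ (ss j) (xs⊒ss j) xsⱼ≡a) (λ i _ → xs⊒ss i)

      Bᵉ<xs : ∀ i → fin (Bᵉ j a) <̄ xs i n
      Bᵉ<xs i = ≤-<̄-trans (xs i n) (Bᵉ≤B j a≤M) (B<xs i)

  bound : ∀ ss → Increasing ss → Acc _<_ (remaining ss) → Σ ℕ (Bounds ss)
  bound ss ss↑ (acc rec) = B , ss-bounded
    where
    open Step ss ss↑ (λ j a ∣ssⱼ∣<n ssⱼa↑ →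
      bound (extend ss j a) (updateAt-pointwise (λ _ → Linked _<_) ss j ssⱼa↑ (λ i _ → ss↑ i))
            (rec (remaining-extend ss j a ∣ssⱼ∣<n)))

lemma4p6 : (k : ℕ) → 1 ≤ k →
    (X : Seq̄ → Set) →
    (∀ x → X x → Is𝕀 x) →
    (∀ (xs : Fin k → Seq̄) → (∀ j → InQ (xs j)) → ∀ j → X (xs j)) →
    (Ψ : (xs : Fin k → Seq̄) → (∀ j → X (xs j)) → ℕ → ℕ) →
    (∀ (p : Fin k → Seq̄) → (∀ j → InQ (p j)) → (hp : ∀ j → X (p j)) → ContinuousAt k X Ψ p hp) →
    Σ (ℕ → ℕ) λ g →
      ∀ (n : ℕ) (xs : Fin k → Seq̄) (hx : ∀ j → X (xs j)) →
        (∀ j → fin (g n) <̄ xs j n) →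
        Ψ xs hx n ≤ g n
lemma4p6 k _ X X⊆𝕀 Qᵏ⊆Xᵏ Ψ Ψ-continuous = g , λ n xs hx → proj₂ (root n) xs hx (λ _ → tt)
  where
  open BoundConstruction k X X⊆𝕀 Qᵏ⊆Xᵏ Ψ Ψ-continuous

  root : ∀ n → Σ ℕ (Bounds n (λ _ → []))
  root n = bound n (λ _ → []) (λ _ → []) (<-wellFounded _)

  g : ℕ → ℕ
  g n = proj₁ (root n)
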